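{- Let $n\ge 3$. There is a map $\Phi$ with the following property. For every $2$-vertex-connected graph $H$ on $n$ vertices and every ordering of $V(H)$, the $(\le n-2)$-graphlet degree distribution of $H$ equals $\Phi$ applied to the $(n-1)$-graphlet degree distribution of $H$. In other words, the $(n-1)$-gdd of a $2$-vertex-connected graph determines its $(\le n-2)$-gdd.
   Context: All graphs are finite, simple and undirected. Let $H$ be a graph on $n$ vertices. A graphlet is a pair $(G,r)$ with $G$ a connected graph with at least one and fewer than $n$ vertices and $r\in V(G)$. Two graphlets are isomorphic if some isomorphism of the graphs maps root to root; graphlets are taken up to isomorphism in a fixed enumeration. For $v\in V(H)$, the graphlet degree of $v$ with respect to $(G,r)$ is the number of sets $S\subseteq V(H)$ with $v\in S$ such that some isomorphism $H[S]\to G$ maps $v$ to $r$. The $m$-gdd (respectively $(\le m)$-gdd) of $H$ is the matrix with rows indexed by the vertices of $H$ and columns by graphlet classes with exactly $m$ (respectively at most $m$) vertices. Its entries are the graphlet degrees. -}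

module Defs where

open import Data.Bool using (Bool; true; false)
import Data.Bool.Properties as BoolP
open import Data.Nat using (ℕ; zero; suc; _≤_)
open import Data.Fin using (Fin)
open import Data.Fin.Properties using (any?; all?; _≟_)
open import Data.Fin.Subset using (Subset; _∈_)
open import Data.Fin.Subset.Properties using (_∈?_)
open import Data.Vec using (Vec; []; _∷_; lookup)
open import Data.List using (List; []; _∷_; map; concatMap; filter; length)
open import Data.List.Membership.Propositional using () renaming (_∈_ to _∈ₗ_)
open import Data.List.Relation.Unary.Any using (Any) renaming (any? to anyₗ?)
open import Data.Product using (Σ; Σ-syntax; ∃; _×_; _,_)
open import Data.Unit using (⊤; tt)
open import Relation.Nullary using (Dec; yes; no)
open import Relation.Nullary.Decidable using (_×-dec_; _→-dec_)
open import Relation.Binary.PropositionalEquality using (_≡_)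

-- A finite simple undirected graph on the vertex set Fin n
-- (the vertex ordering of the paper is the order of Fin n).
record Graph (n : ℕ) : Set where
  field
    adj    : Fin n → Fin n → Bool
    sym    : ∀ i j → adj i j ≡ adj j i
    irrefl : ∀ i → adj i i ≡ false
open Graph public

data ReachIn {n : ℕ} (G : Graph n) (P : Fin n → Set) : Fin n → Fin n → Set where
  here : ∀ {i} → P i → ReachIn G P i i
  step : ∀ {i j k} → P i → adj G i j ≡ true → ReachIn G P j k → ReachIn G P i k

ConnectedOn : {n : ℕ} → Graph n → (Fin n → Set) → Set
ConnectedOn {n} G P = ∀ (i j : Fin n) → P i → P j → ReachIn G P i j

Connected : {n : ℕ} → Graph n → Set
Connected G = ConnectedOn G (λ _ → ⊤)

TwoConnected : {n : ℕ} → Graph n → Set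
TwoConnected {n} G = (3 ≤ n) × Connected G × (∀ (x : Fin n) → ConnectedOn G (λ y → y ≡ x → Data.Empty.⊥))
  where import Data.Empty

-- Rooted connected graphs on exactly m vertices (representatives of
-- graphlets with m vertices; the root forces m ≥ 1).
Graphlet : ℕ → Set
Graphlet m = Σ[ G ∈ Graph m ] (Connected G × Fin m)

-- g : Fin m → Fin n (as a vector) is an isomorphism from G onto H[S]
-- mapping the root r to v (its inverse is the isomorphism H[S] → G).
IsoOnto : {n m : ℕ} → Graph n → Graph m → Fin m → Fin n → Subset n → Vec (Fin n) m → Set
IsoOnto {n} {m} H G r v S g =
  (∀ (i j : Fin m) → lookup g i ≡ lookup g j → i ≡ j) ×
  (∀ (k : Fin n) → (k ∈ S → ∃ λ i → lookup g i ≡ k) × ((∃ λ i → lookup g i ≡ k) → k ∈ S)) ×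
  (lookup g r ≡ v) ×
  (∀ (i j : Fin m) → adj G i j ≡ adj H (lookup g i) (lookup g j))

isoOnto? : {n m : ℕ} (H : Graph n) (G : Graph m) (r : Fin m) (v : Fin n) (S : Subset n) (g : Vec (Fin n) m) →
           Dec (IsoOnto H G r v S g)
isoOnto? H G r v S g =
  all? (λ i → all? (λ j → (lookup g i ≟ lookup g j) →-dec (i ≟ j))) ×-dec
  (all? (λ k → ((k ∈? S) →-dec any? (λ i → lookup g i ≟ k)) ×-dec (any? (λ i → lookup g i ≟ k) →-dec (k ∈? S))) ×-dec
  ((lookup g r ≟ v) ×-dec
  all? (λ i → all? (λ j → adj G i j BoolP.≟ adj H (lookup g i) (lookup g j)))))

allVecs : {A : Set} → List A → (k : ℕ) → List (Vec A k)
allVecs xs zero = [] ∷ []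
allVecs xs (suc k) = concatMap (λ x → map (x ∷_) (allVecs xs k)) xs

allFinList : (n : ℕ) → List (Fin n)
allFinList n = Data.List.allFin n
  where import Data.List

allSubsets : (n : ℕ) → List (Subset n)
allSubsets n = allVecs (true ∷ false ∷ []) n

allMaps : (m n : ℕ) → List (Vec (Fin n) m)
allMaps m n = allVecs (allFinList n) m

graphletDegree : {n m : ℕ} → Graph n → Graphlet m → Fin n → ℕ
graphletDegree {n} {m} H (G , _ , r) v =
  length (filter (λ S → (v ∈? S) ×-dec anyₗ? (isoOnto? H G r v S) (allMaps m n)) (allSubsets n))

gdd : {n : ℕ} → Graph n → (m : ℕ) → Fin n → Graphlet m → ℕ
gdd H m v g = graphletDegree H g v

gddLe : {n : ℕ} → Graph n → (k : ℕ) → Fin n → (m : ℕ) → m ≤ k → Graphlet m → ℕ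
gddLe H k v m _ g = graphletDegree H g v

-- Kelly's lemma: every copy of an m-vertex rooted graphlet g at v misses exactly n − m vertices, so
-- (n − m) · deg_g(v) = Σₓ deg_g(v in H − x), where only x ≠ v contribute. Since H is 2-connected, each
-- card H − x (x ≠ v) rooted at v is a connected (n − 1)-vertex graphlet, and the degree of g at its root
-- is an isomorphism invariant. The (n − 1)-gdd at v counts, for every rooted (n − 1)-vertex graphlet h, the
-- vertices x with (H − x, v) ≅ h, so the right-hand side is a sum over isomorphism classes of h of
-- gdd(v, h) · deg_g(root of h), which is computable from the (n − 1)-gdd alone.

module Submission where

open import Defs hiding (sym)
open import Data.Nat using (ℕ; _≤_; _∸_)
open import Data.Fin using (Fin)
open import Data.Product using (Σ-syntax)
open import Relation.Binary.PropositionalEquality using (_≡_)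

open import Data.Bool using (Bool; true; false)
import Data.Bool.Properties as Bool
open import Data.Empty using (⊥; ⊥-elim)
import Data.Fin as Fin
open import Data.Fin using (punchIn; punchOut)
open import Data.Fin.Properties using (_≟_; any?; all?; punchIn-injective; punchInᵢ≢i; punchIn-punchOut)
open import Data.Fin.Subset using (Subset; ∁; ⁅_⁆) renaming (_∈_ to _∈ₛ_; _∉_ to _∉ₛ_; _⊆_ to _⊆ₛ_; ⊤ to ⊤ₛ)
open import Data.Fin.Subset.Properties
  using (⊆-antisym; ∈⊤; x∈⁅x⁆; x∈∁p⇒x∉p; x∉p⇒x∈∁p; x≢y⇒x∉⁅y⁆; _⊆?_) renaming (_∈?_ to _∈ₛ?_)
open import Data.List using (List; []; _∷_; length; map; filter; concatMap; allFin)
open import Data.List.Properties using (length-map; length-tabulate; filter-none; filter-≐; filter-notAll)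
open import Data.List.Membership.Propositional using (_∈_; lose)
open import Data.List.Membership.Propositional.Properties
  using (∈-map⁺; ∈-map⁻; ∈-concatMap⁺; ∈-concatMap⁻; ∈-filter⁺; ∈-filter⁻; ∈-length; ∈-allFin)
open import Data.List.Membership.Propositional.Properties.WithK using (unique∧set⇒bag)
open import Data.List.Relation.Binary.BagAndSetEquality using (∼bag⇒↭)
open import Data.List.Relation.Binary.Permutation.Propositional.Properties using (↭-length)
open import Data.List.Relation.Unary.All using ([]; _∷_)
import Data.List.Relation.Unary.All as All
import Data.List.Relation.Unary.All.Properties as All
open import Data.List.Relation.Unary.Any using (Any; here; there; satisfied) renaming (any? to anyₗ?)
import Data.List.Relation.Unary.Any as Any
open import Data.List.Relation.Unary.Unique.Propositional using (Unique; []; _∷_)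
import Data.List.Relation.Unary.Unique.Propositional.Properties as Unique
open import Data.Nat using (zero; suc; _+_; _*_; _<_; s≤s; _/_; NonZero; >-nonZero)
open import Data.Nat.Divisibility using (_∣_; 0∣⇒≡0)
open import Data.Nat.DivMod using (m*[n/m]≡n; m*n/n≡m)
open import Data.Nat.ListAction using (product)
open import Data.Nat.ListAction.Properties using (∈⇒∣product; product≢0)
open import Data.Nat.Properties
  using (+-identityʳ; +-suc; *-assoc; *-distribʳ-+; +-commutativeSemigroup; *-commutativeSemigroup;
         m+n∸m≡n; m+n∸n≡m; m∸n≤m; m*n≢0; m<n⇒0<n∸m; <⇒≱; ≤-trans; ≤-pred; ≤-reflexive)
open import Algebra.Properties.CommutativeSemigroup +-commutativeSemigroup using () renaming (interchange to +-interchange)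
open import Algebra.Properties.CommutativeSemigroup *-commutativeSemigroup using (x∙yz≈y∙xz)
open import Data.Product using (∃; _×_; _,_; proj₁; proj₂)
open import Data.Sum using (_⊎_; inj₁; inj₂)
open import Data.Unit using (⊤; tt)
open import Data.Vec using (Vec; []; _∷_; head; lookup; tabulate)
open import Data.Vec.Properties using (∷-injective; lookup∘tabulate; []=⇒lookup; lookup⇒[]=)
open import Function using (_∘_)
open import Function.Bundles using (_⇔_; mk⇔; Equivalence)
open import Relation.Binary.PropositionalEquality using (_≢_; refl; sym; trans; cong; cong₂; subst; module ≡-Reasoning)
open import Relation.Nullary using (Dec; yes; no; ¬_; does)
open import Relation.Nullary.Decidable using (_×-dec_; ¬?; dec-true)
import Relation.Nullary.Decidable as Dec
open import Relation.Unary using (Decidable)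
open import Relation.Unary.Properties using (∁?)

-- Sums and double counting

indicator : {P : Set} → Dec P → ℕ
indicator (yes _) = 1
indicator (no _)  = 0

module _ {A : Set} where

  sumBy : (A → ℕ) → List A → ℕ
  sumBy f []       = 0
  sumBy f (x ∷ xs) = f x + sumBy f xs

  sumBy-cong : ∀ {f g : A → ℕ} → (∀ x → f x ≡ g x) → ∀ xs → sumBy f xs ≡ sumBy g xs
  sumBy-cong f≗g []       = refl
  sumBy-cong f≗g (x ∷ xs) = cong₂ _+_ (f≗g x) (sumBy-cong f≗g xs)

  sumBy-zero : ∀ xs → sumBy (λ _ → 0) xs ≡ 0
  sumBy-zero []       = refl
  sumBy-zero (x ∷ xs) = sumBy-zero xs

  sumBy-+ : ∀ (f g : A → ℕ) xs → sumBy (λ x → f x + g x) xs ≡ sumBy f xs + sumBy g xs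
  sumBy-+ f g []       = refl
  sumBy-+ f g (x ∷ xs) = trans (cong (f x + g x +_) (sumBy-+ f g xs)) (+-interchange (f x) (g x) _ _)

  sumBy-*ʳ : ∀ K (f : A → ℕ) xs → sumBy (λ x → f x * K) xs ≡ sumBy f xs * K
  sumBy-*ʳ K f []       = refl
  sumBy-*ʳ K f (x ∷ xs) = trans (cong (f x * K +_) (sumBy-*ʳ K f xs)) (sym (*-distribʳ-+ K (f x) _))

  sumBy-const : ∀ {f : A → ℕ} K xs → (∀ {x} → x ∈ xs → f x ≡ K) → sumBy f xs ≡ length xs * K
  sumBy-const K []       f≡K = refl
  sumBy-const K (x ∷ xs) f≡K = cong₂ _+_ (f≡K (here refl)) (sumBy-const K xs (λ x∈ → f≡K (there x∈)))

  module _ {P : A → Set} (P? : Decidable P) where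

    length-filter≡sumBy-indicator : ∀ xs → length (filter P? xs) ≡ sumBy (λ x → indicator (P? x)) xs
    length-filter≡sumBy-indicator []       = refl
    length-filter≡sumBy-indicator (x ∷ xs) with P? x
    ... | yes _ = cong suc (length-filter≡sumBy-indicator xs)
    ... | no _  = length-filter≡sumBy-indicator xs

    sumBy-filter : ∀ (w : A → ℕ) xs → sumBy w (filter P? xs) ≡ sumBy (λ x → indicator (P? x) * w x) xs
    sumBy-filter w []       = refl
    sumBy-filter w (x ∷ xs) with P? x
    ... | yes _ = cong₂ _+_ (sym (+-identityʳ (w x))) (sumBy-filter w xs)
    ... | no _  = sumBy-filter w xs

    length-filter+length-filter-∁ : ∀ xs → length (filter P? xs) + length (filter (∁? P?) xs) ≡ length xs
    length-filter+length-filter-∁ []       = refl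
    length-filter+length-filter-∁ (x ∷ xs) with P? x
    ... | yes _ = cong suc (length-filter+length-filter-∁ xs)
    ... | no _  = trans (+-suc _ _) (cong suc (length-filter+length-filter-∁ xs))

module _ {A B : Set} where

  sumBy-comm : ∀ (f : A → B → ℕ) L M →
               sumBy (λ a → sumBy (f a) M) L ≡ sumBy (λ b → sumBy (λ a → f a b) L) M
  sumBy-comm f []      M = sym (sumBy-zero M)
  sumBy-comm f (a ∷ L) M = trans (cong (sumBy (f a) M +_) (sumBy-comm f L M))
                                 (sym (sumBy-+ (f a) _ M))

  sumBy-length-filter : ∀ {R : A → B → Set} (R? : ∀ a b → Dec (R a b)) (w : A → ℕ) L M →
    sumBy (λ a → length (filter (R? a) M) * w a) L ≡ sumBy (λ b → sumBy w (filter (λ a → R? a b) L)) M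
  sumBy-length-filter R? w L M = begin
    sumBy (λ a → length (filter (R? a) M) * w a) L
      ≡⟨ sumBy-cong (λ a → cong (_* w a) (length-filter≡sumBy-indicator (R? a) M)) L ⟩
    sumBy (λ a → sumBy (λ b → indicator (R? a b)) M * w a) L
      ≡⟨ sumBy-cong (λ a → sym (sumBy-*ʳ (w a) _ M)) L ⟩
    sumBy (λ a → sumBy (λ b → indicator (R? a b) * w a) M) L
      ≡⟨ sumBy-comm _ L M ⟩
    sumBy (λ b → sumBy (λ a → indicator (R? a b) * w a) L) M
      ≡⟨ sumBy-cong (λ b → sym (sumBy-filter (λ a → R? a b) w L)) M ⟩
    sumBy (λ b → sumBy w (filter (λ a → R? a b) L)) M ∎
    where open ≡-Reasoning

-- Enumerations and subsets

unique∧set⇒length≡ : ∀ {A : Set} {xs ys : List A} → Unique xs → Unique ys →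
                     (∀ {z} → z ∈ xs → z ∈ ys) → (∀ {z} → z ∈ ys → z ∈ xs) → length xs ≡ length ys
unique∧set⇒length≡ xs! ys! xs⊆ys ys⊆xs = ↭-length (∼bag⇒↭ (unique∧set⇒bag xs! ys! (mk⇔ xs⊆ys ys⊆xs)))

module _ {A : Set} {xs : List A} where

  ∈-allVecs : ∀ {k} (u : Vec A k) → (∀ i → lookup u i ∈ xs) → u ∈ allVecs xs k
  ∈-allVecs []      _     = here refl
  ∈-allVecs (x ∷ u) u⊆xs =
    ∈-concatMap⁺ (λ y → map (y ∷_) (allVecs xs _))
      (Any.map (λ { refl → ∈-map⁺ (x ∷_) (∈-allVecs u (λ i → u⊆xs (Fin.suc i))) }) (u⊆xs Fin.zero))

  Unique-allVecs : Unique xs → ∀ k → Unique (allVecs xs k)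
  Unique-allVecs xs! zero    = [] ∷ []
  Unique-allVecs xs! (suc k) = prepend-all xs!
    where
    tails : List (Vec A k)
    tails = allVecs xs k

    head-of : ∀ {y} {u : Vec A (suc k)} → u ∈ map (y ∷_) tails → head u ≡ y
    head-of u∈ with ∈-map⁻ _ u∈
    ... | _ , _ , refl = refl

    prepend-all : ∀ {ys} → Unique ys → Unique (concatMap (λ y → map (y ∷_) tails) ys)
    prepend-all []           = []
    prepend-all (y∉ys ∷ ys!) =
      Unique.++⁺ (Unique.map⁺ (proj₂ ∘ ∷-injective) (Unique-allVecs xs! k)) (prepend-all ys!)
      λ { (u∈ , u∈′) → All.lookup y∉ys (subst (_∈ _) (head-of u∈) (Any.map head-of (∈-concatMap⁻ _ u∈′))) refl }

∈-bools : ∀ b → b ∈ true ∷ false ∷ []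
∈-bools true  = here refl
∈-bools false = there (here refl)

∈-allSubsets : ∀ {n} (S : Subset n) → S ∈ allSubsets n
∈-allSubsets S = ∈-allVecs S (λ i → ∈-bools (lookup S i))

Unique-allSubsets : ∀ n → Unique (allSubsets n)
Unique-allSubsets = Unique-allVecs (((λ ()) ∷ []) ∷ [] ∷ [])

∈-allMaps : ∀ {m n} (γ : Vec (Fin n) m) → γ ∈ allMaps m n
∈-allMaps γ = ∈-allVecs γ (λ i → ∈-allFin _)

subsetOf : ∀ {n} {P : Fin n → Set} → Decidable P → Subset n
subsetOf P? = tabulate (does ∘ P?)

module _ {n} {P : Fin n → Set} (P? : Decidable P) {y : Fin n} where

  ∈-subsetOf⁺ : P y → y ∈ₛ subsetOf P?
  ∈-subsetOf⁺ py = lookup⇒[]= y _ (trans (lookup∘tabulate _ y) (dec-true (P? y) py))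

  ∈-subsetOf⁻ : y ∈ₛ subsetOf P? → P y
  ∈-subsetOf⁻ y∈ with P? y | trans (sym (lookup∘tabulate (does ∘ P?) y)) ([]=⇒lookup y∈)
  ... | yes py | _ = py

∈∁⁅⁆⇒≢ : ∀ {n} {x y : Fin n} → y ∈ₛ ∁ ⁅ x ⁆ → y ≢ x
∈∁⁅⁆⇒≢ {x = x} y∈ refl = x∈∁p⇒x∉p y∈ (x∈⁅x⁆ x)

≢⇒∈∁⁅⁆ : ∀ {n} {x y : Fin n} → y ≢ x → y ∈ₛ ∁ ⁅ x ⁆
≢⇒∈∁⁅⁆ y≢x = x∉p⇒x∈∁p (x≢y⇒x∉⁅y⁆ y≢x)

∁⁅⁆-injective : ∀ {n} {x y : Fin n} → ∁ ⁅ x ⁆ ≡ ∁ ⁅ y ⁆ → x ≡ y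
∁⁅⁆-injective {x = x} {y} eq with x ≟ y
... | yes x≡y = x≡y
... | no x≢y  = ⊥-elim (∈∁⁅⁆⇒≢ (subst (x ∈ₛ_) (sym eq) (≢⇒∈∁⁅⁆ x≢y)) refl)

module _ {n} {S : Subset n} {x : Fin n} where

  ∉⇒⊆∁⁅⁆ : x ∉ₛ S → S ⊆ₛ ∁ ⁅ x ⁆
  ∉⇒⊆∁⁅⁆ x∉S {y} y∈S = ≢⇒∈∁⁅⁆ λ { refl → x∉S y∈S }

  ⊆∁⁅⁆⇒∉ : S ⊆ₛ ∁ ⁅ x ⁆ → x ∉ₛ S
  ⊆∁⁅⁆⇒∉ S⊆ x∈S = ∈∁⁅⁆⇒≢ (S⊆ x∈S) refl

-- Copies of rooted graphs

record Copy {n m} (H : Graph n) (G : Graph m) (r : Fin m) (v : Fin n) (S : Subset n) : Set where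
  constructor copy
  field
    embedding : Vec (Fin n) m
    isoOnto   : IsoOnto H G r v S embedding

  injective : ∀ i j → lookup embedding i ≡ lookup embedding j → i ≡ j
  injective = proj₁ isoOnto

  covers : ∀ {y} → y ∈ₛ S → ∃ λ i → lookup embedding i ≡ y
  covers = proj₁ (proj₁ (proj₂ isoOnto) _)

  into : ∀ i → lookup embedding i ∈ₛ S
  into i = proj₂ (proj₁ (proj₂ isoOnto) _) (i , refl)

  root : lookup embedding r ≡ v
  root = proj₁ (proj₂ (proj₂ isoOnto))

  adjacency : ∀ i j → adj G i j ≡ adj H (lookup embedding i) (lookup embedding j)
  adjacency = proj₂ (proj₂ (proj₂ isoOnto))

  root∈ : v ∈ₛ S
  root∈ = subst (_∈ₛ S) root (into r)

  size : length (filter (_∈ₛ? S) (allFin n)) ≡ m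
  size = begin
    length (filter (_∈ₛ? S) (allFin n))
      ≡⟨ unique∧set⇒length≡ (Unique.filter⁺ (_∈ₛ? S) {allFin n} (Unique.allFin⁺ n))
                             (Unique.map⁺ (injective _ _) {allFin m} (Unique.allFin⁺ m)) ⊆image image⊆ ⟩
    length (map (lookup embedding) (allFin m))   ≡⟨ length-map (lookup embedding) (allFin m) ⟩
    length (allFin m)                            ≡⟨ length-tabulate (λ i → i) ⟩
    m ∎
    where
    open ≡-Reasoning
    ⊆image : ∀ {y} → y ∈ filter (_∈ₛ? S) (allFin n) → y ∈ map (lookup embedding) (allFin m)
    ⊆image y∈ with covers (proj₂ (∈-filter⁻ (_∈ₛ? S) {xs = allFin n} y∈))
    ... | i , refl = ∈-map⁺ (lookup embedding) (∈-allFin i)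
    image⊆ : ∀ {y} → y ∈ map (lookup embedding) (allFin m) → y ∈ filter (_∈ₛ? S) (allFin n)
    image⊆ y∈ with ∈-map⁻ (lookup embedding) y∈
    ... | i , _ , refl = ∈-filter⁺ (_∈ₛ? S) (∈-allFin _) (into i)

  size-∁ : length (filter (∁? (_∈ₛ? S)) (allFin n)) ≡ n ∸ m
  size-∁ = begin
    length (filter (∁? (_∈ₛ? S)) (allFin n))
      ≡⟨ sym (m+n∸m≡n m _) ⟩
    m + length (filter (∁? (_∈ₛ? S)) (allFin n)) ∸ m
      ≡⟨ cong (λ l → l + length (filter (∁? (_∈ₛ? S)) (allFin n)) ∸ m) (sym size) ⟩
    length (filter (_∈ₛ? S) (allFin n)) + length (filter (∁? (_∈ₛ? S)) (allFin n)) ∸ m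
      ≡⟨ cong (_∸ m) (length-filter+length-filter-∁ (_∈ₛ? S) (allFin n)) ⟩
    length (allFin n) ∸ m
      ≡⟨ cong (_∸ m) (length-tabulate (λ i → i)) ⟩
    n ∸ m ∎
    where open ≡-Reasoning

copy? : ∀ {n m} (H : Graph n) (G : Graph m) r v → Decidable (Copy H G r v)
copy? {n} {m} H G r v S = Dec.map′ (λ any → let (γ , iso) = satisfied any in copy γ iso)
                                   (λ (copy γ iso) → lose (∈-allMaps γ) iso)
                                   (anyₗ? (isoOnto? H G r v S) (allMaps m n))

graphletDegree≡ : ∀ {n m} (H : Graph n) (G : Graph m) (G-connected : Connected G) r v →
                  graphletDegree H (G , G-connected , r) v ≡ length (filter (copy? H G r v) (allSubsets n))
graphletDegree≡ {n} {m} H G _ r v = cong length (filter-≐ rootedIso? (copy? H G r v) (to , from) (allSubsets n))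
  where
  RootedIso : Subset n → Set
  RootedIso S = v ∈ₛ S × Any (IsoOnto H G r v S) (allMaps m n)
  rootedIso? : Decidable RootedIso
  rootedIso? S = (v ∈ₛ? S) ×-dec anyₗ? (isoOnto? H G r v S) (allMaps m n)
  to : ∀ {S} → RootedIso S → Copy H G r v S
  to (_ , any) = let (γ , iso) = satisfied any in copy γ iso
  from : ∀ {S} → Copy H G r v S → RootedIso S
  from c = Copy.root∈ c , lose (∈-allMaps (Copy.embedding c)) (Copy.isoOnto c)

copy-resp-adj : ∀ {n m} {H : Graph n} {G G′ : Graph m} {r v S} → (∀ i j → adj G′ i j ≡ adj G i j) →
                Copy H G r v S → Copy H G′ r v S
copy-resp-adj G′≗G (copy γ (inj , onto , root , adjG)) =
  copy γ (inj , onto , root , λ i j → trans (G′≗G i j) (adjG i j))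

copy-refl : ∀ {m} (G : Graph m) r → Copy G G r r ⊤ₛ
copy-refl G r = copy (tabulate (λ i → i))
  ( (λ i j eq → trans (sym (≡id i)) (trans eq (≡id j)))
  , (λ y → (λ _ → y , ≡id y) , (λ _ → ∈⊤))
  , ≡id r
  , (λ i j → sym (cong₂ (adj G) (≡id i) (≡id j))) )
  where
  ≡id : ∀ i → lookup (tabulate (λ i → i)) i ≡ i
  ≡id = lookup∘tabulate (λ i → i)

-- A copy γ of B on S₀ identifies subsets of V(B) with subsets of S₀, carrying copies along.
module Embedding {n k} {H : Graph n} {B : Graph k} {b : Fin k} {v : Fin n} {S₀ : Subset n}
                 (γ : Copy H B b v S₀) where

  private module γ = Copy γ

  inImage? : (T : Subset k) → Decidable (λ y → ∃ λ i → lookup γ.embedding i ≡ y × i ∈ₛ T)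
  inImage? T y = any? (λ i → (lookup γ.embedding i ≟ y) ×-dec (i ∈ₛ? T))

  inPreimage? : (S : Subset n) → Decidable (λ i → lookup γ.embedding i ∈ₛ S)
  inPreimage? S i = lookup γ.embedding i ∈ₛ? S

  image : Subset k → Subset n
  image T = subsetOf (inImage? T)

  preimage : Subset n → Subset k
  preimage S = subsetOf (inPreimage? S)

  ∈-image⁺ : ∀ {T i} → i ∈ₛ T → lookup γ.embedding i ∈ₛ image T
  ∈-image⁺ {T} i∈T = ∈-subsetOf⁺ (inImage? T) (_ , refl , i∈T)

  ∈-image⁻ : ∀ {T y} → y ∈ₛ image T → ∃ λ i → lookup γ.embedding i ≡ y × i ∈ₛ T
  ∈-image⁻ {T} = ∈-subsetOf⁻ (inImage? T)

  image-⊆ : ∀ {T} → image T ⊆ₛ S₀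
  image-⊆ y∈ with ∈-image⁻ y∈
  ... | i , refl , _ = γ.into i

  image-injective : ∀ {T T′} → image T ≡ image T′ → T ≡ T′
  image-injective eq = ⊆-antisym (image-reflects-⊆ eq) (image-reflects-⊆ (sym eq))
    where
    image-reflects-⊆ : ∀ {T T′} → image T ≡ image T′ → T ⊆ₛ T′
    image-reflects-⊆ eq {i} i∈T with ∈-image⁻ (subst (lookup γ.embedding i ∈ₛ_) eq (∈-image⁺ i∈T))
    ... | j , γj≡γi , j∈T′ = subst (_∈ₛ _) (γ.injective _ _ γj≡γi) j∈T′

  image-preimage : ∀ {S} → S ⊆ₛ S₀ → image (preimage S) ≡ S
  image-preimage {S} S⊆S₀ = ⊆-antisym image⊆ ⊆image
    where
    image⊆ : image (preimage S) ⊆ₛ S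
    image⊆ y∈ with ∈-image⁻ y∈
    ... | i , refl , i∈ = ∈-subsetOf⁻ (inPreimage? S) i∈
    ⊆image : S ⊆ₛ image (preimage S)
    ⊆image y∈S with γ.covers (S⊆S₀ y∈S)
    ... | i , refl = ∈-image⁺ (∈-subsetOf⁺ (inPreimage? S) y∈S)

  preimage-S₀ : preimage S₀ ≡ ⊤ₛ
  preimage-S₀ = ⊆-antisym (λ _ → ∈⊤) (λ {i} _ → ∈-subsetOf⁺ (inPreimage? S₀) (γ.into i))

  image-⊤ : image ⊤ₛ ≡ S₀
  image-⊤ = trans (cong image (sym preimage-S₀)) (image-preimage (λ y∈ → y∈))

  module _ {j} {A : Graph j} {a : Fin j} where

    compose : ∀ {T} → Copy B A a b T → Copy H A a v (image T)
    compose {T} δ = copy (tabulate γδ) (injective , onto , root , adjacency)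
      where
      module δ = Copy δ
      γδ : Fin j → Fin n
      γδ = lookup γ.embedding ∘ lookup δ.embedding
      ≡γδ : ∀ i → lookup (tabulate γδ) i ≡ γδ i
      ≡γδ = lookup∘tabulate γδ

      injective : ∀ i i′ → lookup (tabulate γδ) i ≡ lookup (tabulate γδ) i′ → i ≡ i′
      injective i i′ eq = δ.injective _ _ (γ.injective _ _ (trans (sym (≡γδ i)) (trans eq (≡γδ i′))))

      onto : ∀ y → (y ∈ₛ image T → ∃ λ i → lookup (tabulate γδ) i ≡ y) ×
                   ((∃ λ i → lookup (tabulate γδ) i ≡ y) → y ∈ₛ image T)
      onto y = covers , λ { (i , eq) → subst (_∈ₛ image T) (trans (sym (≡γδ i)) eq) (∈-image⁺ (δ.into i)) }
        where
        covers : y ∈ₛ image T → ∃ λ i → lookup (tabulate γδ) i ≡ y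
        covers y∈ with ∈-image⁻ y∈
        ... | i , refl , i∈T with δ.covers i∈T
        ...   | i′ , refl = i′ , ≡γδ i′

      root : lookup (tabulate γδ) a ≡ v
      root = trans (≡γδ a) (trans (cong (lookup γ.embedding) δ.root) γ.root)

      adjacency : ∀ i i′ → adj A i i′ ≡ adj H (lookup (tabulate γδ) i) (lookup (tabulate γδ) i′)
      adjacency i i′ = trans (δ.adjacency i i′) (trans (γ.adjacency _ _) (sym (cong₂ (adj H) (≡γδ i) (≡γδ i′))))

    restrict : ∀ {S} → Copy H A a v S → S ⊆ₛ S₀ → Copy B A a b (preimage S)
    restrict {S} ε S⊆S₀ = copy δ (injective , onto , root , adjacency)
      where
      module ε = Copy ε
      lift : ∀ i → ∃ λ i′ → lookup γ.embedding i′ ≡ lookup ε.embedding i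
      lift i = γ.covers (S⊆S₀ (ε.into i))
      δ : Vec (Fin k) j
      δ = tabulate (proj₁ ∘ lift)
      γδ≡ε : ∀ i → lookup γ.embedding (lookup δ i) ≡ lookup ε.embedding i
      γδ≡ε i = trans (cong (lookup γ.embedding) (lookup∘tabulate _ i)) (proj₂ (lift i))

      injective : ∀ i i′ → lookup δ i ≡ lookup δ i′ → i ≡ i′
      injective i i′ eq = ε.injective _ _ (trans (sym (γδ≡ε i)) (trans (cong (lookup γ.embedding) eq) (γδ≡ε i′)))

      onto : ∀ i → (i ∈ₛ preimage S → ∃ λ i′ → lookup δ i′ ≡ i) × ((∃ λ i′ → lookup δ i′ ≡ i) → i ∈ₛ preimage S)
      onto i = covers , λ { (i′ , refl) → ∈-subsetOf⁺ (inPreimage? S) (subst (_∈ₛ S) (sym (γδ≡ε i′)) (ε.into i′)) }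
        where
        covers : i ∈ₛ preimage S → ∃ λ i′ → lookup δ i′ ≡ i
        covers i∈ with ε.covers (∈-subsetOf⁻ (inPreimage? S) i∈)
        ... | i′ , εi′≡γi = i′ , γ.injective _ _ (trans (γδ≡ε i′) εi′≡γi)

      root : lookup δ a ≡ b
      root = γ.injective _ _ (trans (γδ≡ε a) (trans ε.root (sym γ.root)))

      adjacency : ∀ i i′ → adj A i i′ ≡ adj B (lookup δ i) (lookup δ i′)
      adjacency i i′ = trans (ε.adjacency i i′) (trans (sym (cong₂ (adj H) (γδ≡ε i) (γδ≡ε i′))) (sym (γ.adjacency _ _)))

    copy-⊤⇔copy-S₀ : Copy B A a b ⊤ₛ ⇔ Copy H A a v S₀
    copy-⊤⇔copy-S₀ = mk⇔ (subst (Copy H A a v) image-⊤ ∘ compose)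
                          (λ ε → subst (Copy B A a b) preimage-S₀ (restrict ε (λ y∈ → y∈)))

    count-copies : length (filter (copy? B A a b) (allSubsets k)) ≡
                   length (filter (λ S → copy? H A a v S ×-dec (S ⊆? S₀)) (allSubsets n))
    count-copies = trans (sym (length-map image (filter (copy? B A a b) (allSubsets k))))
      (unique∧set⇒length≡ (Unique.map⁺ image-injective (Unique.filter⁺ (copy? B A a b) (Unique-allSubsets k)))
                          (Unique.filter⁺ _ (Unique-allSubsets n)) images⊆ ⊆images)
      where
      images⊆ : ∀ {S} → S ∈ map image (filter (copy? B A a b) (allSubsets k)) →
                S ∈ filter (λ S → copy? H A a v S ×-dec (S ⊆? S₀)) (allSubsets n)
      images⊆ S∈ with ∈-map⁻ image S∈
      ... | T , T∈ , refl = ∈-filter⁺ _ (∈-allSubsets (image T))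
        (compose (proj₂ (∈-filter⁻ (copy? B A a b) {xs = allSubsets k} T∈)) , λ {y} → image-⊆ {T} {y})
      ⊆images : ∀ {S} → S ∈ filter (λ S → copy? H A a v S ×-dec (S ⊆? S₀)) (allSubsets n) →
                S ∈ map image (filter (copy? B A a b) (allSubsets k))
      ⊆images {S} S∈ with proj₂ (∈-filter⁻ (λ S → copy? H A a v S ×-dec (S ⊆? S₀)) {xs = allSubsets n} S∈)
      ... | ε , S⊆S₀ = subst (_∈ _) (image-preimage S⊆S₀)
                         (∈-map⁺ image (∈-filter⁺ (copy? B A a b) (∈-allSubsets _) (restrict ε S⊆S₀)))

-- Counting copies

module _ {n m} (H : Graph n) (G : Graph m) (r : Fin m) (v : Fin n) where

  copies : ℕ
  copies = length (filter (copy? H G r v) (allSubsets n))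

  avoids? : (x : Fin n) → Decidable (λ S → Copy H G r v S × S ⊆ₛ ∁ ⁅ x ⁆)
  avoids? x S = copy? H G r v S ×-dec (S ⊆? ∁ ⁅ x ⁆)

  copiesAvoiding : Fin n → ℕ
  copiesAvoiding x = length (filter (avoids? x) (allSubsets n))

  private
    avoided-by : ∀ S (c? : Dec (Copy H G r v S)) →
                 length (filter (λ x → c? ×-dec (S ⊆? ∁ ⁅ x ⁆)) (allFin n)) ≡ indicator c? * (n ∸ m)
    avoided-by S (no ¬c) =
      cong length (filter-none (λ x → no ¬c ×-dec (S ⊆? ∁ ⁅ x ⁆)) {allFin n} (All.tabulate (λ _ → ¬c ∘ proj₁)))
    avoided-by S (yes c) = begin
      length (filter (λ x → yes c ×-dec (S ⊆? ∁ ⁅ x ⁆)) (allFin n))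
        ≡⟨ cong length (filter-≐ _ (∁? (_∈ₛ? S)) (⊆∁⁅⁆⇒∉ ∘ proj₂ , λ x∉S → c , ∉⇒⊆∁⁅⁆ x∉S) (allFin n)) ⟩
      length (filter (∁? (_∈ₛ? S)) (allFin n))
        ≡⟨ Copy.size-∁ c ⟩
      n ∸ m
        ≡⟨ sym (+-identityʳ (n ∸ m)) ⟩
      1 * (n ∸ m) ∎
      where open ≡-Reasoning

  kellyLemma : sumBy copiesAvoiding (allFin n) ≡ copies * (n ∸ m)
  kellyLemma = begin
    sumBy (λ x → length (filter (avoids? x) (allSubsets n))) (allFin n)
      ≡⟨ sumBy-cong (λ x → length-filter≡sumBy-indicator (avoids? x) (allSubsets n)) (allFin n) ⟩
    sumBy (λ x → sumBy (λ S → indicator (avoids? x S)) (allSubsets n)) (allFin n)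
      ≡⟨ sumBy-comm _ (allFin n) (allSubsets n) ⟩
    sumBy (λ S → sumBy (λ x → indicator (avoids? x S)) (allFin n)) (allSubsets n)
      ≡⟨ sumBy-cong (λ S → sym (length-filter≡sumBy-indicator (λ x → avoids? x S) (allFin n))) (allSubsets n) ⟩
    sumBy (λ S → length (filter (λ x → avoids? x S) (allFin n))) (allSubsets n)
      ≡⟨ sumBy-cong (λ S → avoided-by S (copy? H G r v S)) (allSubsets n) ⟩
    sumBy (λ S → indicator (copy? H G r v S) * (n ∸ m)) (allSubsets n)
      ≡⟨ sumBy-*ʳ (n ∸ m) _ (allSubsets n) ⟩
    sumBy (λ S → indicator (copy? H G r v S)) (allSubsets n) * (n ∸ m)
      ≡⟨ cong (_* (n ∸ m)) (sym (length-filter≡sumBy-indicator (copy? H G r v) (allSubsets n))) ⟩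
    copies * (n ∸ m) ∎
    where open ≡-Reasoning

module _ {k} (H : Graph (suc k)) (G : Graph k) (r : Fin k) (v : Fin (suc k)) where

  copy-omits-one-vertex : ∀ {S} → Copy H G r v S → ∃ λ x → S ≡ ∁ ⁅ x ⁆
  copy-omits-one-vertex {S} c
    with filter (∁? (_∈ₛ? S)) (allFin (suc k)) in outside≡ | trans (Copy.size-∁ c) (m+n∸n≡m 1 k)
  ... | x ∷ [] | _ = x , ⊆-antisym (λ y∈S → ≢⇒∈∁⁅⁆ λ { refl → x∉S y∈S }) ∈∁⁅x⁆⇒∈S
    where
    x∉S : x ∉ₛ S
    x∉S = proj₂ (∈-filter⁻ (∁? (_∈ₛ? S)) {xs = allFin (suc k)} (subst (x ∈_) (sym outside≡) (here refl)))
    ∈∁⁅x⁆⇒∈S : ∀ {y} → y ∈ₛ ∁ ⁅ x ⁆ → y ∈ₛ S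
    ∈∁⁅x⁆⇒∈S {y} y∈ with y ∈ₛ? S
    ... | yes y∈S = y∈S
    ... | no y∉S with subst (y ∈_) outside≡ (∈-filter⁺ (∁? (_∈ₛ? S)) (∈-allFin y) y∉S)
    ...   | here y≡x = ⊥-elim (∈∁⁅⁆⇒≢ y∈ y≡x)

  copies≡count-∁⁅⁆ : copies H G r v ≡ length (filter (λ x → copy? H G r v (∁ ⁅ x ⁆)) (allFin (suc k)))
  copies≡count-∁⁅⁆ = trans
    (unique∧set⇒length≡ (Unique.filter⁺ (copy? H G r v) (Unique-allSubsets (suc k)))
                        (Unique.map⁺ ∁⁅⁆-injective
                          (Unique.filter⁺ (λ x → copy? H G r v (∁ ⁅ x ⁆)) {allFin (suc k)} (Unique.allFin⁺ _)))
                        ⊆complements complements⊆)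
    (length-map (λ x → ∁ ⁅ x ⁆) (filter (λ x → copy? H G r v (∁ ⁅ x ⁆)) (allFin (suc k))))
    where
    ⊆complements : ∀ {S} → S ∈ filter (copy? H G r v) (allSubsets (suc k)) →
                   S ∈ map (λ x → ∁ ⁅ x ⁆) (filter (λ x → copy? H G r v (∁ ⁅ x ⁆)) (allFin (suc k)))
    ⊆complements S∈ with proj₂ (∈-filter⁻ (copy? H G r v) {xs = allSubsets (suc k)} S∈)
    ... | c with copy-omits-one-vertex c
    ...   | x , refl = ∈-map⁺ (λ x → ∁ ⁅ x ⁆) (∈-filter⁺ (λ x → copy? H G r v (∁ ⁅ x ⁆)) (∈-allFin x) c)
    complements⊆ : ∀ {S} → S ∈ map (λ x → ∁ ⁅ x ⁆) (filter (λ x → copy? H G r v (∁ ⁅ x ⁆)) (allFin (suc k))) →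
                   S ∈ filter (copy? H G r v) (allSubsets (suc k))
    complements⊆ S∈ with ∈-map⁻ (λ x → ∁ ⁅ x ⁆) S∈
    ... | x , x∈ , refl = ∈-filter⁺ (copy? H G r v) (∈-allSubsets _)
                            (proj₂ (∈-filter⁻ (λ x → copy? H G r v (∁ ⁅ x ⁆)) {xs = allFin (suc k)} x∈))

-- Connectivity and the enumeration of graphlets

ReachIn-mono : ∀ {k} {G : Graph k} {P Q : Fin k → Set} → (∀ {y} → P y → Q y) →
               ∀ {i j} → ReachIn G P i j → ReachIn G Q i j
ReachIn-mono P⇒Q (here p)       = here (P⇒Q p)
ReachIn-mono P⇒Q (step p e walk) = step (P⇒Q p) e (ReachIn-mono P⇒Q walk)

ReachIn-source : ∀ {k} {G : Graph k} {P : Fin k → Set} {i j} → ReachIn G P i j → P i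
ReachIn-source (here p)     = p
ReachIn-source (step p _ _) = p

ReachIn-resp-adj : ∀ {k} {G G′ : Graph k} {P : Fin k → Set} → (∀ i j → adj G′ i j ≡ adj G i j) →
                   ∀ {i j} → ReachIn G P i j → ReachIn G′ P i j
ReachIn-resp-adj G′≗G (here p)         = here p
ReachIn-resp-adj G′≗G (step p i~l walk) = step p (trans (G′≗G _ _) i~l) (ReachIn-resp-adj G′≗G walk)

module _ {k} (G : Graph k) where

  open import Data.List.Membership.DecPropositional (_≟_ {k}) using (_∈?_)

  private
    without : Fin k → List (Fin k) → List (Fin k)
    without i = filter (λ y → ¬? (y ≟ i))

    without⁺ : ∀ {i y xs} → y ∈ xs → y ≢ i → y ∈ without i xs
    without⁺ {i} = ∈-filter⁺ (λ y → ¬? (y ≟ i))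

    after-last-visit : ∀ {xs a j} i → ReachIn G (_∈ xs) a j → j ≢ i →
                       ReachIn G (_∈ without i xs) a j ⊎
                       ∃ λ l → adj G i l ≡ true × ReachIn G (_∈ without i xs) l j
    after-last-visit i (here a∈) j≢i = inj₁ (here (without⁺ a∈ j≢i))
    after-last-visit {a = a} i (step {j = l} a∈ a~l walk) j≢i with after-last-visit i walk j≢i
    ... | inj₂ rest = inj₂ rest
    ... | inj₁ walk′ with a ≟ i
    ...   | yes refl = inj₂ (l , a~l , walk′)
    ...   | no a≢i   = inj₁ (step (without⁺ a∈ a≢i) a~l walk′)

  reachIn? : ∀ fuel xs → length xs ≤ fuel → ∀ i j → Dec (ReachIn G (_∈ xs) i j)
  leave? : ∀ fuel xs → length xs ≤ fuel → ∀ i j → i ∈ xs → i ≢ j → Dec (ReachIn G (_∈ xs) i j)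

  reachIn? fuel xs len i j with i ∈? xs
  ... | no i∉ = no λ walk → i∉ (ReachIn-source walk)
  ... | yes i∈ with i ≟ j
  ...   | yes refl = yes (here i∈)
  ...   | no i≢j   = leave? fuel xs len i j i∈ i≢j

  -- A walk from i to j ≢ i may be taken to leave i for good after its first step, so the recursive
  -- search runs in the smaller vertex list without i.
  leave? zero       xs len i j i∈ i≢j = ⊥-elim (<⇒≱ (∈-length i∈) len)
  leave? (suc fuel) xs len i j i∈ i≢j
    with any? (λ l → (adj G i l Bool.≟ true) ×-dec reachIn? fuel (without i xs) shorter l j)
    where
    shorter : length (without i xs) ≤ fuel
    shorter = ≤-pred (≤-trans (filter-notAll (λ y → ¬? (y ≟ i)) xs (Any.map (λ { refl ne → ne refl }) i∈)) len)
  ... | yes (l , i~l , walk) =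
    yes (step i∈ i~l (ReachIn-mono (λ y∈ → proj₁ (∈-filter⁻ (λ y → ¬? (y ≟ i)) {xs = xs} y∈)) walk))
  ... | no ¬first-step = no λ walk → refute (after-last-visit i walk (i≢j ∘ sym))
    where
    refute : ReachIn G (_∈ without i xs) i j ⊎ (∃ λ l → adj G i l ≡ true × ReachIn G (_∈ without i xs) l j) → ⊥
    refute (inj₁ walk′)       = proj₂ (∈-filter⁻ (λ y → ¬? (y ≟ i)) {xs = xs} (ReachIn-source walk′)) refl
    refute (inj₂ first-step) = ¬first-step first-step

  connected? : Dec (Connected G)
  connected? with all? (λ i → all? (λ j → reachIn? k (allFin k) (≤-reflexive (length-tabulate (λ i → i))) i j))
  ... | yes reach = yes λ i j _ _ → ReachIn-mono (λ _ → tt) (reach i j)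
  ... | no ¬reach = no λ conn → ¬reach λ i j → ReachIn-mono (λ {y} _ → ∈-allFin y) (conn i j tt tt)

graph : ∀ {m} → Graphlet m → Graph m
graph = proj₁

root : ∀ {m} → Graphlet m → Fin m
root = proj₂ ∘ proj₂

module _ (k : ℕ) where

  private
    Matrix = Vec (Vec Bool k) k

    entry : Matrix → Fin k → Fin k → Bool
    entry M i j = lookup (lookup M i) j

    Symmetric Irreflexive : Matrix → Set
    Symmetric M   = ∀ i j → entry M i j ≡ entry M j i
    Irreflexive M = ∀ i → entry M i i ≡ false

    rootings : (G : Graph k) → Dec (Connected G) → List (Graphlet k)
    rootings G (yes conn) = map (λ r → G , conn , r) (allFin k)
    rootings G (no _)     = []

    fromMatrix : (M : Matrix) → Dec (Symmetric M) → Dec (Irreflexive M) → List (Graphlet k)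
    fromMatrix M (yes s) (yes irr) = rootings G (connected? G)
      where
      G : Graph k
      G = record { adj = entry M ; sym = s ; irrefl = irr }
    fromMatrix M _       _         = []

    symmetric? : ∀ M → Dec (Symmetric M)
    symmetric? M = all? (λ i → all? (λ j → entry M i j Bool.≟ entry M j i))

    irreflexive? : ∀ M → Dec (Irreflexive M)
    irreflexive? M = all? (λ i → entry M i i Bool.≟ false)

  graphlets : List (Graphlet k)
  graphlets = concatMap (λ M → fromMatrix M (symmetric? M) (irreflexive? M))
                        (allVecs (allVecs (true ∷ false ∷ []) k) k)

  graphlets-complete : (G : Graph k) → Connected G → (r : Fin k) →
                       ∃ λ h → h ∈ graphlets × (∀ i j → adj (graph h) i j ≡ adj G i j) × root h ≡ r
  graphlets-complete G conn r = enlarge (fromMatrix-complete (symmetric? M) (irreflexive? M))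
    where
    M : Matrix
    M = tabulate (λ i → tabulate (adj G i))

    entry-M : ∀ i j → entry M i j ≡ adj G i j
    entry-M i j = trans (cong (λ row → lookup row j) (lookup∘tabulate _ i)) (lookup∘tabulate _ j)

    Found : List (Graphlet k) → Set
    Found hs = ∃ λ h → h ∈ hs × (∀ i j → adj (graph h) i j ≡ adj G i j) × root h ≡ r

    fromMatrix-complete : ∀ s? irr? → Found (fromMatrix M s? irr?)
    fromMatrix-complete (yes s) (yes irr) = rootings-complete (connected? G′)
      where
      G′ : Graph k
      G′ = record { adj = entry M ; sym = s ; irrefl = irr }
      rootings-complete : ∀ conn? → Found (rootings G′ conn?)
      rootings-complete (yes conn′) = (G′ , conn′ , r) , ∈-map⁺ _ (∈-allFin r) , entry-M , refl
      rootings-complete (no ¬conn′) =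
        ⊥-elim (¬conn′ λ i j _ _ → ReachIn-resp-adj (λ i j → entry-M i j) (conn i j tt tt))
    fromMatrix-complete (no ¬s) _ =
      ⊥-elim (¬s λ i j → trans (entry-M i j) (trans (Graph.sym G i j) (sym (entry-M j i))))
    fromMatrix-complete (yes _) (no ¬irr) = ⊥-elim (¬irr λ i → trans (entry-M i i) (irrefl G i))

    enlarge : Found (fromMatrix M (symmetric? M) (irreflexive? M)) → Found graphlets
    enlarge (h , h∈ , same-adj , same-root) =
      h , ∈-concatMap⁺ _ (lose (∈-allVecs M (λ i → ∈-allVecs _ (λ j → ∈-bools _))) h∈) , same-adj , same-root

-- Vertex deletion

_─_ : ∀ {k} → Graph (suc k) → Fin (suc k) → Graph k
H ─ x = record
  { adj    = λ i j → adj H (punchIn x i) (punchIn x j)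
  ; sym    = λ i j → Graph.sym H (punchIn x i) (punchIn x j)
  ; irrefl = λ i → irrefl H (punchIn x i)
  }

module _ {k} (H : Graph (suc k)) (x : Fin (suc k)) where

  ─-connected : ConnectedOn H (_≢ x) → Connected (H ─ x)
  ─-connected conn i j _ _ =
    unlift (conn (punchIn x i) (punchIn x j) (punchInᵢ≢i x i) (punchInᵢ≢i x j)) refl refl
    where
    unlift : ∀ {a b i j} → ReachIn H (_≢ x) a b → punchIn x i ≡ a → punchIn x j ≡ b →
             ReachIn (H ─ x) (λ _ → ⊤) i j
    unlift {i = i} {j} (here _) refl b≡ =
      subst (ReachIn (H ─ x) _ i) (punchIn-injective x i j (sym b≡)) (here tt)
    unlift {i = i} (step {j = l} _ a~l walk) refl b≡ =
      step tt (subst (λ l′ → adj H (punchIn x i) l′ ≡ true) (sym (punchIn-punchOut x≢l)) a~l)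
              (unlift walk (punchIn-punchOut x≢l) b≡)
      where
      x≢l : x ≢ l
      x≢l x≡l = ReachIn-source walk (sym x≡l)

  deletion-copy : ∀ {v} (x≢v : x ≢ v) → Copy H (H ─ x) (punchOut x≢v) v (∁ ⁅ x ⁆)
  deletion-copy {v} x≢v = copy (tabulate (punchIn x)) (injective , onto , root′ , adjacency)
    where
    ≡punchIn : ∀ i → lookup (tabulate (punchIn x)) i ≡ punchIn x i
    ≡punchIn = lookup∘tabulate (punchIn x)

    injective : ∀ i j → lookup (tabulate (punchIn x)) i ≡ lookup (tabulate (punchIn x)) j → i ≡ j
    injective i j eq = punchIn-injective x i j (trans (sym (≡punchIn i)) (trans eq (≡punchIn j)))

    onto : ∀ y → (y ∈ₛ ∁ ⁅ x ⁆ → ∃ λ i → lookup (tabulate (punchIn x)) i ≡ y) ×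
                 ((∃ λ i → lookup (tabulate (punchIn x)) i ≡ y) → y ∈ₛ ∁ ⁅ x ⁆)
    onto y = (λ y∈ → let x≢y = ∈∁⁅⁆⇒≢ y∈ ∘ sym in punchOut x≢y , trans (≡punchIn _) (punchIn-punchOut x≢y))
           , (λ { (i , refl) → ≢⇒∈∁⁅⁆ (punchInᵢ≢i x i ∘ trans (sym (≡punchIn i))) })

    root′ : lookup (tabulate (punchIn x)) (punchOut x≢v) ≡ v
    root′ = trans (≡punchIn _) (punchIn-punchOut x≢v)

    adjacency : ∀ i j → adj (H ─ x) i j ≡ adj H (lookup (tabulate (punchIn x)) i) (lookup (tabulate (punchIn x)) j)
    adjacency i j = sym (cong₂ (adj H) (≡punchIn i) (≡punchIn j))

-- The reconstruction map

-- Division with the junk value n /₀ 0 = 0.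
infixl 7 _/₀_
_/₀_ : ℕ → ℕ → ℕ
n /₀ zero  = 0
n /₀ suc d = n / suc d

m∣n⇒m*[n/₀m]≡n : ∀ {m n} → m ∣ n → m * (n /₀ m) ≡ n
m∣n⇒m*[n/₀m]≡n {zero}  0∣n = sym (0∣⇒≡0 0∣n)
m∣n⇒m*[n/₀m]≡n {suc m} m∣n = m*[n/m]≡n m∣n

m*n/₀n≡m : ∀ m n .{{_ : NonZero n}} → m * n /₀ n ≡ m
m*n/₀n≡m m (suc n) = m*n/n≡m m (suc n)

module Reconstruction (k : ℕ) where

  isomorphic? : (h h′ : Graphlet k) → Dec (Copy (graph h) (graph h′) (root h′) (root h) ⊤ₛ)
  isomorphic? h h′ = copy? (graph h) (graph h′) (root h′) (root h) ⊤ₛ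

  classSize : Graphlet k → ℕ
  classSize h = length (filter (isomorphic? h) (graphlets k))

  scale : ℕ
  scale = product (map classSize (graphlets k))

  instance
    scale-nonZero : NonZero scale
    scale-nonZero = product≢0 (All.map⁺ (All.tabulate {xs = graphlets k} λ {h} h∈ →
      >-nonZero (∈-length (∈-filter⁺ (isomorphic? h) h∈ (copy-refl (graph h) (root h))))))

  -- The enumeration lists each isomorphism class classSize h times; the factor scale / classSize h
  -- makes every class count exactly scale times, and Φ divides scale out again.
  weight : ∀ {m} → Graphlet m → Graphlet k → ℕ
  weight g h = copies (graph h) (graph g) (root g) (root h) * (scale /₀ classSize h)

  Φ : (Fin (suc k) → Graphlet k → ℕ) → Fin (suc k) → (m : ℕ) → Graphlet m → ℕ
  Φ D v m g = sumBy (λ h → D v h * weight g h) (graphlets k) /₀ ((suc k ∸ m) * scale)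

  module _ (H : Graph (suc k)) (H-2conn : TwoConnected H) (v : Fin (suc k)) {m} (g : Graphlet m) where

    -- h represents the card H ─ x, rooted at v.
    isCard? : (x : Fin (suc k)) → Decidable (λ (h : Graphlet k) → Copy H (graph h) (root h) v (∁ ⁅ x ⁆))
    isCard? x h = copy? H (graph h) (root h) v (∁ ⁅ x ⁆)

    private
      open ≡-Reasoning

      avoiding : Fin (suc k) → ℕ
      avoiding = copiesAvoiding H (graph g) (root g) v

      Cards : Fin (suc k) → List (Graphlet k)
      Cards x = filter (isCard? x) (graphlets k)

    classSize-of-card : ∀ x h → Copy H (graph h) (root h) v (∁ ⁅ x ⁆) → classSize h ≡ length (Cards x)
    classSize-of-card x h γ = cong length (filter-≐ (isomorphic? h) (isCard? x)
      ( (λ {h′} → Equivalence.to (copy-⊤⇔copy-S₀ {A = graph h′}))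
      , (λ {h′} → Equivalence.from (copy-⊤⇔copy-S₀ {A = graph h′})) )
      (graphlets k))
      where open Embedding γ

    weight-of-card : ∀ x h → Copy H (graph h) (root h) v (∁ ⁅ x ⁆) →
                     weight g h ≡ avoiding x * (scale /₀ length (Cards x))
    weight-of-card x h γ = cong₂ _*_ (Embedding.count-copies γ) (cong (scale /₀_) (classSize-of-card x h γ))

    length-Cards∣scale : ∀ {x} → x ≢ v → length (Cards x) ∣ scale
    length-Cards∣scale {x} x≢v
      with graphlets-complete k (H ─ x) (─-connected H x (proj₂ (proj₂ H-2conn) x)) (punchOut x≢v)
    ... | h , h∈ , same-adj , same-root =
      subst (_∣ scale) (classSize-of-card x h γ) (∈⇒∣product (∈-map⁺ classSize h∈))
      where
      γ : Copy H (graph h) (root h) v (∁ ⁅ x ⁆)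
      γ = subst (λ a → Copy H (graph h) a v (∁ ⁅ x ⁆)) (sym same-root)
                (copy-resp-adj same-adj (deletion-copy H x x≢v))

    sumBy-weight-Cards : ∀ x → sumBy (weight g) (Cards x) ≡ avoiding x * scale
    sumBy-weight-Cards x with x ≟ v
    ... | yes refl = begin
      sumBy (weight g) (Cards x)
        ≡⟨ cong (sumBy (weight g)) (filter-none (isCard? x) {graphlets k}
             (All.tabulate λ _ γ → root-avoided γ (λ y∈ → y∈))) ⟩
      0
        ≡⟨ cong (_* scale) (sym (cong length (filter-none (avoids? H (graph g) (root g) v x) {allSubsets (suc k)}
             (All.tabulate λ _ (γ , S⊆) → root-avoided γ S⊆)))) ⟩
      avoiding x * scale ∎
      where
      root-avoided : ∀ {j} {A : Graph j} {a S} → Copy H A a v S → ¬ S ⊆ₛ ∁ ⁅ v ⁆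
      root-avoided γ S⊆ = ∈∁⁅⁆⇒≢ (S⊆ (Copy.root∈ γ)) refl
    ... | no x≢v = begin
      sumBy (weight g) (Cards x)
        ≡⟨ sumBy-const _ (Cards x) (λ {h} h∈ →
             weight-of-card x h (proj₂ (∈-filter⁻ (isCard? x) {xs = graphlets k} h∈))) ⟩
      length (Cards x) * (avoiding x * (scale /₀ length (Cards x)))
        ≡⟨ x∙yz≈y∙xz (length (Cards x)) (avoiding x) _ ⟩
      avoiding x * (length (Cards x) * (scale /₀ length (Cards x)))
        ≡⟨ cong (avoiding x *_) (m∣n⇒m*[n/₀m]≡n (length-Cards∣scale x≢v)) ⟩
      avoiding x * scale ∎

    sumBy-gdd-weight : sumBy (λ h → gdd H k v h * weight g h) (graphlets k) ≡
                       copies H (graph g) (root g) v * ((suc k ∸ m) * scale)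
    sumBy-gdd-weight = begin
      sumBy (λ h → gdd H k v h * weight g h) (graphlets k)
        ≡⟨ sumBy-cong (λ h → cong (_* weight g h) (trans (graphletDegree≡ H (graph h) (proj₁ (proj₂ h)) (root h) v)
                                                         (copies≡count-∁⁅⁆ H (graph h) (root h) v)))
                      (graphlets k) ⟩
      sumBy (λ h → length (filter (λ x → isCard? x h) (allFin (suc k))) * weight g h) (graphlets k)
        ≡⟨ sumBy-length-filter (λ h x → isCard? x h) (weight g) (graphlets k) (allFin (suc k)) ⟩
      sumBy (λ x → sumBy (weight g) (Cards x)) (allFin (suc k))
        ≡⟨ sumBy-cong sumBy-weight-Cards (allFin (suc k)) ⟩
      sumBy (λ x → avoiding x * scale) (allFin (suc k))
        ≡⟨ sumBy-*ʳ scale avoiding (allFin (suc k)) ⟩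
      sumBy avoiding (allFin (suc k)) * scale
        ≡⟨ cong (_* scale) (kellyLemma H (graph g) (root g) v) ⟩
      copies H (graph g) (root g) v * (suc k ∸ m) * scale
        ≡⟨ *-assoc (copies H (graph g) (root g) v) (suc k ∸ m) scale ⟩
      copies H (graph g) (root g) v * ((suc k ∸ m) * scale) ∎

    Φ-correct : m < suc k → graphletDegree H g v ≡ Φ (gdd H k) v m g
    Φ-correct m<n = sym (begin
      Φ (gdd H k) v m g
        ≡⟨ cong (_/₀ ((suc k ∸ m) * scale)) sumBy-gdd-weight ⟩
      copies H (graph g) (root g) v * ((suc k ∸ m) * scale) /₀ ((suc k ∸ m) * scale)
        ≡⟨ m*n/₀n≡m _ _ {{m*n≢0 _ _ {{>-nonZero (m<n⇒0<n∸m m<n)}}}} ⟩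
      copies H (graph g) (root g) v
        ≡⟨ sym (graphletDegree≡ H (graph g) (proj₁ (proj₂ g)) (root g) v) ⟩
      graphletDegree H g v ∎)

-- The hypothesis 3 ≤ n only excludes n = 0; 2-connectivity of H is what the argument uses.
mainTheorem5 : (n : ℕ) → 3 ≤ n →
    Σ[ Φ ∈ ((Fin n → Graphlet (n ∸ 1) → ℕ) → (Fin n → (m : ℕ) → m ≤ n ∸ 2 → Graphlet m → ℕ)) ]
      (∀ (H : Graph n) → TwoConnected H →
        ∀ (v : Fin n) (m : ℕ) (le : m ≤ n ∸ 2) (g : Graphlet m) →
          gddLe H (n ∸ 2) v m le g ≡ Φ (gdd H (n ∸ 1)) v m le g)
mainTheorem5 zero    ()
mainTheorem5 (suc k) _ =
  (λ D v m _ → Reconstruction.Φ k D v m) ,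
  (λ H H-2conn v m m≤k∸1 g → Reconstruction.Φ-correct k H H-2conn v g (s≤s (≤-trans m≤k∸1 (m∸n≤m k 1))))
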